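{- Let $\Omega$ be a finite set and $\Omega_\pm=\{+,-\}\times\Omega$. For every $\zeta\in\mathrm{Sym}(\Omega_\pm)$ there is $\sigma\in\mathrm{Sym}(\Omega_\pm)$ that commutes with the sign flip, i.e. $\sigma(-\mathrm{Id})=(-\mathrm{Id})\sigma$, and satisfies $d_H(\sigma,\zeta)\le d_H([-\mathrm{Id},\zeta],\mathrm{Id})$, where $[a,b]=aba^{ -1}b^{ -1}$.
   Context: Elements of $\Omega_\pm$ are written $\pm\star$ for $\star\in\Omega$; the sign flip $-\mathrm{Id}\in\mathrm{Sym}(\Omega_\pm)$ maps $+\star\mapsto-\star$ and $-\star\mapsto+\star$. For $\sigma,\sigma'\in\mathrm{Sym}(\Omega_\pm)$, $d_H(\sigma,\sigma')=\Pr_{\spadesuit\in\Omega_\pm}[\sigma.\spadesuit\ne\sigma'.\spadesuit]$ (uniform probability). -}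

module Defs where

open import Data.Bool using (Bool; true; false; not; if_then_else_)
open import Data.Nat using (ℕ; _+_)
open import Data.Fin using (Fin)
open import Data.Fin.Properties using (_≟_)
open import Data.Product using (_×_; _,_)
open import Data.List using (List; _∷_; []; map; _++_; length; filter)
open import Data.List.Base using (allFin)
open import Function using (_∘_)
open import Function.Bundles using (_↔_; Inverse)
open import Relation.Binary.PropositionalEquality using (_≡_)
open import Relation.Nullary using (¬?)
open import Relation.Nullary.Decidable using (Dec)

-- Signs: true = +, false = -.
Sign : Set
Sign = Bool

Ωpm : ℕ → Set
Ωpm n = Sign × Fin n

Sym : ℕ → Set
Sym n = Ωpm n ↔ Ωpm n

app : ∀ {n} → Sym n → Ωpm n → Ωpm n
app σ = Inverse.to σ

inv : ∀ {n} → Sym n → Sym n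
inv σ = record
  { to = Inverse.from σ ; from = Inverse.to σ
  ; to-cong = Inverse.from-cong σ ; from-cong = Inverse.to-cong σ
  ; inverse = Inverse.inverseʳ σ , Inverse.inverseˡ σ }

_∘ₛ_ : ∀ {n} → Sym n → Sym n → Sym n
a ∘ₛ b = record
  { to = Inverse.to a ∘ Inverse.to b
  ; from = Inverse.from b ∘ Inverse.from a
  ; to-cong = λ { _≡_.refl → _≡_.refl }
  ; from-cong = λ { _≡_.refl → _≡_.refl }
  ; inverse = (λ { {x} {y} _≡_.refl → lemmaL x })
            , (λ { {x} {y} _≡_.refl → lemmaR x }) }
  where
  open import Relation.Binary.PropositionalEquality using (refl; cong; trans)
  lemmaL : ∀ x → Inverse.to a (Inverse.to b (Inverse.from b (Inverse.from a x))) ≡ x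
  lemmaL x = trans (cong (Inverse.to a) (Inverse.strictlyInverseˡ b _)) (Inverse.strictlyInverseˡ a x)
  lemmaR : ∀ x → Inverse.from b (Inverse.from a (Inverse.to a (Inverse.to b x))) ≡ x
  lemmaR x = trans (cong (Inverse.from b) (Inverse.strictlyInverseʳ a _)) (Inverse.strictlyInverseʳ b x)

idₛ : ∀ {n} → Sym n
idₛ = record
  { to = λ x → x ; from = λ x → x
  ; to-cong = λ p → p ; from-cong = λ p → p
  ; inverse = (λ p → p) , (λ p → p) }

flip : ∀ {n} → Ωpm n → Ωpm n
flip (s , ω) = (not s , ω)

negId : ∀ {n} → Sym n
negId = record
  { to = flip ; from = flip
  ; to-cong = λ { _≡_.refl → _≡_.refl }
  ; from-cong = λ { _≡_.refl → _≡_.refl }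
  ; inverse = (λ { {s , ω} _≡_.refl → invo s ω }) , (λ { {s , ω} _≡_.refl → invo s ω }) }
  where
  invo : ∀ {n} (s : Sign) (ω : Fin n) → flip (flip (s , ω)) ≡ (s , ω)
  invo true ω = _≡_.refl
  invo false ω = _≡_.refl

⟦_,_⟧ : ∀ {n} → Sym n → Sym n → Sym n
⟦ a , b ⟧ = a ∘ₛ (b ∘ₛ (inv a ∘ₛ inv b))

elems : (n : ℕ) → List (Ωpm n)
elems n = map (true ,_) (allFin n) ++ map (false ,_) (allFin n)

_≟±_ : ∀ {n} (x y : Ωpm n) → Dec (x ≡ y)
_≟±_ = Data.Product.Properties.≡-dec Data.Bool.Properties._≟_ _≟_
  where import Data.Product.Properties
        import Data.Bool.Properties

-- Unnormalised Hamming distance: number of points of Ω± where σ and σ' differ.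
-- The normalised d_H is this count divided by |Ω±| = 2n.
hamCount : ∀ {n} → Sym n → Sym n → ℕ
hamCount {n} σ σ' = length (filter (λ x → ¬? (app σ x ≟± app σ' x)) (elems n))

-- A point x is fixed by the commutator [ι, ζ] exactly when ζ commutes with ι at ζ⁻¹ x, so the
-- commutator moves as many points as there are points w with ζ (ι w) ≠ ι (ζ w), the defect of ζ.
-- If ζ fails to commute with ι at y, composing ζ with the transposition of ζ (ι y) and ι (ζ y)
-- changes ζ at two points only, makes it commute with ι at y and ι y, and keeps every point where it
-- already commuted: the defect drops by at least 2 while the Hamming distance to ζ grows by at most 2.
-- Repeating this until the defect vanishes yields σ.
module Submission where

open import Defs
open import Level using (0ℓ)
open import Data.Bool using (true; false)
open import Data.Bool.Properties using (not-involutive; not-¬)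
open import Data.Nat using (ℕ; _≤_; _<_; _+_; suc; z≤n; s≤s)
open import Data.Nat.Properties
  using (≤-reflexive; ≤-trans; n≤1+n; m≤m+n; +-suc; +-comm; +-identityʳ; +-mono-≤; +-monoˡ-≤; module ≤-Reasoning)
open import Data.Nat.Induction using (<-wellFounded)
open import Data.Product using (Σ; _×_; _,_; proj₁)
open import Data.Product.Properties using (,-injectiveʳ)
open import Data.Sum using (_⊎_; inj₁; inj₂)
open import Data.List using (List; []; _∷_; length; filter; map; allFin)
open import Data.List.Properties using (filter-none; filter-some; filter-≐)
open import Data.List.Relation.Unary.All as All using (all?)
open import Data.List.Relation.Unary.All.Properties using (¬All⇒Any¬)
open import Data.List.Relation.Unary.Any using (satisfied)
open import Data.List.Relation.Unary.AllPairs using (_∷_)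
open import Data.List.Relation.Unary.Unique.Propositional using (Unique)
import Data.List.Relation.Unary.Unique.Propositional.Properties as Unique
open import Data.List.Membership.Propositional using (_∈_; lose)
open import Data.List.Membership.Propositional.Properties
  using (∈-map⁺; ∈-map⁻; ∈-++⁺ˡ; ∈-++⁺ʳ; ∈-allFin)
open import Data.List.Membership.Propositional.Properties.WithK using (unique∧set⇒bag)
open import Data.List.Relation.Binary.BagAndSetEquality using (∼bag⇒↭)
open import Data.List.Relation.Binary.Permutation.Propositional using (_↭_)
open import Data.List.Relation.Binary.Permutation.Propositional.Properties using (↭-length; filter-↭)
open import Data.List.Relation.Binary.Sublist.Propositional using (⊆-refl)
open import Data.List.Relation.Binary.Sublist.Propositional.Properties using (filter⁺; length-mono-≤)
open import Function using (_∘_)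
open import Function.Bundles using (_↔_; Inverse; Injection; mk↔ₛ′; mk⇔)
open import Function.Construct.Composition using (_↔-∘_)
open import Function.Properties.Inverse using (↔⇒↣)
import Induction.WellFounded as WellFounded
import Relation.Binary.Construct.On as On
open import Relation.Binary.Definitions using (DecidableEquality)
open import Relation.Binary.PropositionalEquality
  using (_≡_; _≢_; refl; sym; trans; cong; subst; ≢-sym; module ≡-Reasoning)
open import Relation.Nullary using (¬_; yes; no; does; ¬?; contradiction)
open import Relation.Unary using (Pred; Decidable; _⊆_; _≐_; _⊥_)
open import Relation.Unary.Properties using (_∪?_; _∩?_)

open Inverse using (to; from; strictlyInverseˡ; strictlyInverseʳ)

to-injective : ∀ {A : Set} (f : A ↔ A) {x y} → to f x ≡ to f y → x ≡ y
to-injective f = Injection.injective (↔⇒↣ f)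

count : ∀ {a p} {A : Set a} {P : Pred A p} → Decidable P → List A → ℕ
count P? xs = length (filter P? xs)

module _ {a} {A : Set a} where

  module _ {p q} {P : Pred A p} {Q : Pred A q} (P? : Decidable P) (Q? : Decidable Q) where

    count-mono : P ⊆ Q → ∀ xs → count P? xs ≤ count Q? xs
    count-mono P⊆Q xs = length-mono-≤ (filter⁺ P? Q? (λ { refl → P⊆Q }) (⊆-refl {x = xs}))

    count-cong : P ≐ Q → ∀ xs → count P? xs ≡ count Q? xs
    count-cong P≐Q xs = cong length (filter-≐ P? Q? P≐Q xs)

    count-∪+count-∩ : ∀ xs → count (P? ∪? Q?) xs + count (P? ∩? Q?) xs ≡ count P? xs + count Q? xs
    count-∪+count-∩ [] = refl
    count-∪+count-∩ (x ∷ xs) with does (P? x) | does (Q? x)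
    ... | true  | true  =
      cong suc (trans (+-suc _ _) (trans (cong suc (count-∪+count-∩ xs)) (sym (+-suc _ _))))
    ... | true  | false = cong suc (count-∪+count-∩ xs)
    ... | false | true  = trans (cong suc (count-∪+count-∩ xs)) (sym (+-suc _ _))
    ... | false | false = count-∪+count-∩ xs

    count-∪ : ∀ xs → count (P? ∪? Q?) xs ≤ count P? xs + count Q? xs
    count-∪ xs = begin
      count (P? ∪? Q?) xs                        ≤⟨ m≤m+n _ _ ⟩
      count (P? ∪? Q?) xs + count (P? ∩? Q?) xs  ≡⟨ count-∪+count-∩ xs ⟩
      count P? xs + count Q? xs                  ∎
      where open ≤-Reasoning

    count-∪-disjoint : P ⊥ Q → ∀ xs → count (P? ∪? Q?) xs ≡ count P? xs + count Q? xs
    count-∪-disjoint P⊥Q xs = begin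
      count (P? ∪? Q?) xs                        ≡⟨ +-identityʳ _ ⟨
      count (P? ∪? Q?) xs + 0                    ≡⟨ cong (λ ys → count (P? ∪? Q?) xs + length ys) none ⟨
      count (P? ∪? Q?) xs + count (P? ∩? Q?) xs  ≡⟨ count-∪+count-∩ xs ⟩
      count P? xs + count Q? xs                  ∎
      where
      open ≡-Reasoning
      none : filter (P? ∩? Q?) xs ≡ []
      none = filter-none (P? ∩? Q?) (All.universal (λ _ → P⊥Q) xs)

  count-map : ∀ {b p} {B : Set b} {P : Pred A p} (P? : Decidable P) (f : B → A) xs →
              count P? (map f xs) ≡ count (λ x → P? (f x)) xs
  count-map P? f [] = refl
  count-map P? f (x ∷ xs) with does (P? (f x))
  ... | true  = cong suc (count-map P? f xs)
  ... | false = count-map P? f xs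

module _ {A : Set} (_≟_ : DecidableEquality A) where

  count-≡-≤1 : ∀ {xs} → Unique xs → ∀ u → count (_≟ u) xs ≤ 1
  count-≡-≤1 {[]} _ u = z≤n
  count-≡-≤1 {x ∷ xs} (x∉xs ∷ xs!) u with x ≟ u
  ... | yes refl = s≤s (≤-reflexive (cong length (filter-none (_≟ x) (All.map ≢-sym x∉xs))))
  ... | no _ = count-≡-≤1 xs! u

  count-≡-≥1 : ∀ {xs u} → u ∈ xs → 1 ≤ count (_≟ u) xs
  count-≡-≥1 {u = u} u∈xs = filter-some (_≟ u) (lose u∈xs refl)

  swap : A → A → A → A
  swap u v x with x ≟ u
  ... | yes _ = v
  ... | no _ with x ≟ v
  ...   | yes _ = u
  ...   | no _ = x

  swap-left : ∀ u v → swap u v u ≡ v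
  swap-left u v with u ≟ u
  ... | yes _ = refl
  ... | no u≢u = contradiction refl u≢u

  swap-right : ∀ u v → swap u v v ≡ u
  swap-right u v with v ≟ u
  ... | yes v≡u = v≡u
  ... | no _ with v ≟ v
  ...   | yes _ = refl
  ...   | no v≢v = contradiction refl v≢v

  swap-other : ∀ {u v x} → x ≢ u → x ≢ v → swap u v x ≡ x
  swap-other {u} {v} {x} x≢u x≢v with x ≟ u
  ... | yes x≡u = contradiction x≡u x≢u
  ... | no _ with x ≟ v
  ...   | yes x≡v = contradiction x≡v x≢v
  ...   | no _ = refl

  swap-moves : ∀ {u v x} → swap u v x ≢ x → x ≡ u ⊎ x ≡ v
  swap-moves {u} {v} {x} moved with x ≟ u
  ... | yes x≡u = inj₁ x≡u
  ... | no _ with x ≟ v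
  ...   | yes x≡v = inj₂ x≡v
  ...   | no _ = contradiction refl moved

  swap-involutive : ∀ u v x → swap u v (swap u v x) ≡ x
  swap-involutive u v x with x ≟ u
  ... | yes refl = swap-right x v
  ... | no x≢u with x ≟ v
  ...   | yes refl = swap-left u x
  ...   | no x≢v = swap-other x≢u x≢v

  transposition : A → A → A ↔ A
  transposition u v = mk↔ₛ′ (swap u v) (swap u v) (swap-involutive u v) (swap-involutive u v)

module _ {A : Set} {enum : List A} (enum-unique : Unique enum) (enum-complete : ∀ x → x ∈ enum) where

  map-↔-↭ : (f : A ↔ A) → map (to f) enum ↭ enum
  map-↔-↭ f = ∼bag⇒↭ (unique∧set⇒bag (Unique.map⁺ (to-injective f) enum-unique) enum-unique
    λ {x} → mk⇔ (λ _ → enum-complete x) (λ _ → ∈-image x))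
    where
    ∈-image : ∀ x → x ∈ map (to f) enum
    ∈-image x = subst (_∈ map (to f) enum) (strictlyInverseˡ f x) (∈-map⁺ (to f) (enum-complete (from f x)))

  count-∘-↔ : ∀ {p} {P : Pred A p} (P? : Decidable P) (f : A ↔ A) →
              count P? enum ≡ count (λ x → P? (to f x)) enum
  count-∘-↔ P? f = trans (sym (↭-length (filter-↭ P? (map-↔-↭ f)))) (count-map P? (to f) enum)

module CommutingApproximation
  {A : Set} (_≟_ : DecidableEquality A)
  (ι : A → A) (ι-involutive : ∀ x → ι (ι x) ≡ x) (ι-fixedPointFree : ∀ x → ι x ≢ x)
  {enum : List A} (enum-unique : Unique enum) (enum-complete : ∀ x → x ∈ enum)
  where

  ι-transpose : ∀ {x y} → ι x ≡ y → x ≡ ι y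
  ι-transpose {x} refl = sym (ι-involutive x)

  CommutesAt : A ↔ A → Pred A 0ℓ
  CommutesAt ζ w = to ζ (ι w) ≡ ι (to ζ w)

  commutesAt? : ∀ ζ → Decidable (CommutesAt ζ)
  commutesAt? ζ w = to ζ (ι w) ≟ ι (to ζ w)

  commutesAt-ι : ∀ ζ {w} → CommutesAt ζ w → CommutesAt ζ (ι w)
  commutesAt-ι ζ {w} c = trans (cong (to ζ) (ι-involutive w)) (ι-transpose (sym c))

  defect : A ↔ A → ℕ
  defect ζ = count (¬? ∘ commutesAt? ζ) enum

  differ? : (σ ζ : A ↔ A) → Decidable (λ x → to σ x ≢ to ζ x)
  differ? σ ζ x = ¬? (to σ x ≟ to ζ x)

  distance : A ↔ A → A ↔ A → ℕ
  distance σ ζ = count (differ? σ ζ) enum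

  -- The number of points moved by [ι, ζ] = ι ζ ι⁻¹ ζ⁻¹, where ι⁻¹ = ι.
  commutatorSupport : A ↔ A → ℕ
  commutatorSupport ζ = count (λ x → ¬? (ι (to ζ (ι (from ζ x))) ≟ x)) enum

  commutatorSupport≡defect : ∀ ζ → commutatorSupport ζ ≡ defect ζ
  commutatorSupport≡defect ζ =
    trans (count-∘-↔ enum-unique enum-complete _ ζ)
          (count-cong _ _ (fixed⊆commutes , commutes⊆fixed) enum)
    where
    cancel : ∀ w → ι (to ζ (ι (from ζ (to ζ w)))) ≡ ι (to ζ (ι w))
    cancel w = cong (ι ∘ to ζ ∘ ι) (strictlyInverseʳ ζ w)
    fixed⊆commutes : ∀ {w} → ¬ ι (to ζ (ι (from ζ (to ζ w)))) ≡ to ζ w → ¬ CommutesAt ζ w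
    fixed⊆commutes {w} ¬fixed c = ¬fixed (trans (cancel w) (sym (ι-transpose (sym c))))
    commutes⊆fixed : ∀ {w} → ¬ CommutesAt ζ w → ¬ ι (to ζ (ι (from ζ (to ζ w)))) ≡ to ζ w
    commutes⊆fixed {w} ¬c fixed = ¬c (ι-transpose (trans (sym (cancel w)) fixed))

  distance-triangle : (σ ρ ζ : A ↔ A) → distance σ ζ ≤ distance σ ρ + distance ρ ζ
  distance-triangle σ ρ ζ = begin
    distance σ ζ                             ≤⟨ count-mono (differ? σ ζ) (differ? σ ρ ∪? differ? ρ ζ) via-ρ enum ⟩
    count (differ? σ ρ ∪? differ? ρ ζ) enum  ≤⟨ count-∪ (differ? σ ρ) (differ? ρ ζ) enum ⟩
    distance σ ρ + distance ρ ζ              ∎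
    where
    open ≤-Reasoning
    via-ρ : ∀ {x} → to σ x ≢ to ζ x → to σ x ≢ to ρ x ⊎ to ρ x ≢ to ζ x
    via-ρ {x} σx≢ζx with to σ x ≟ to ρ x
    ... | yes σx≡ρx = inj₂ (λ ρx≡ζx → σx≢ζx (trans σx≡ρx ρx≡ζx))
    ... | no σx≢ρx = inj₁ σx≢ρx

  repair : A ↔ A → A → A ↔ A
  repair ζ y = transposition _≟_ (to ζ (ι y)) (ι (to ζ y)) ↔-∘ ζ

  module Repair (ζ : A ↔ A) {y : A} (y-bad : ¬ CommutesAt ζ y) where

    τ : A → A
    τ = swap _≟_ (to ζ (ι y)) (ι (to ζ y))

    ι-commuting≢y : ∀ {w} → CommutesAt ζ w → ι w ≢ y
    ι-commuting≢y c ιw≡y = y-bad (subst (CommutesAt ζ) ιw≡y (commutesAt-ι ζ c))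

    τ-fixes-commuting : ∀ {w} → CommutesAt ζ w → τ (to ζ w) ≡ to ζ w
    τ-fixes-commuting {w} c = swap-other _≟_ ≢ζιy ≢ιζy
      where
      ≢ζιy : to ζ w ≢ to ζ (ι y)
      ≢ζιy e = ι-commuting≢y c (sym (ι-transpose (sym (to-injective ζ e))))
      ≢ιζy : to ζ w ≢ ι (to ζ y)
      ≢ιζy e = ι-commuting≢y c (to-injective ζ (trans c (sym (ι-transpose (sym e)))))

    commutesAt-repair : ∀ {w} → CommutesAt ζ w → CommutesAt (repair ζ y) w
    commutesAt-repair {w} c = begin
      τ (to ζ (ι w))  ≡⟨ τ-fixes-commuting (commutesAt-ι ζ c) ⟩
      to ζ (ι w)      ≡⟨ c ⟩
      ι (to ζ w)      ≡⟨ cong ι (τ-fixes-commuting c) ⟨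
      ι (τ (to ζ w))  ∎
      where open ≡-Reasoning

    repair-commutesAt : CommutesAt (repair ζ y) y
    repair-commutesAt = begin
      τ (to ζ (ι y))  ≡⟨ swap-left _≟_ _ _ ⟩
      ι (to ζ y)      ≡⟨ cong ι (swap-other _≟_ ζy≢ζιy (≢-sym (ι-fixedPointFree _))) ⟨
      ι (τ (to ζ y))  ∎
      where
      open ≡-Reasoning
      ζy≢ζιy : to ζ y ≢ to ζ (ι y)
      ζy≢ζιy e = ι-fixedPointFree y (sym (to-injective ζ e))

    repair-moves : ∀ {x} → to (repair ζ y) x ≢ to ζ x → x ≡ ι y ⊎ x ≡ from ζ (ι (to ζ y))
    repair-moves {x} moved with swap-moves _≟_ moved
    ... | inj₁ e = inj₁ (to-injective ζ e)
    ... | inj₂ e = inj₂ (trans (sym (strictlyInverseʳ ζ x)) (cong (from ζ) e))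

    ιy-bad : ¬ CommutesAt ζ (ι y)
    ιy-bad c = ι-commuting≢y c (ι-involutive y)

    defect-repair : 2 + defect (repair ζ y) ≤ defect ζ
    defect-repair = begin
      1 + 1 + defect (repair ζ y)
        ≤⟨ +-monoˡ-≤ _ (+-mono-≤ (count-≡-≥1 _≟_ (enum-complete y)) (count-≡-≥1 _≟_ (enum-complete (ι y)))) ⟩
      count (_≟ y) enum + count (_≟ ι y) enum + defect (repair ζ y)
        ≡⟨ cong (_+ defect (repair ζ y)) (count-∪-disjoint (_≟ y) (_≟ ι y) y≢ιy enum) ⟨
      count pair? enum + defect (repair ζ y)
        ≡⟨ count-∪-disjoint pair? bad′? pair⊥bad′ enum ⟨
      count (pair? ∪? bad′?) enum
        ≤⟨ count-mono (pair? ∪? bad′?) (¬? ∘ commutesAt? ζ) ⊆bad enum ⟩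
      defect ζ
        ∎
      where
      open ≤-Reasoning
      pair? = (_≟ y) ∪? (_≟ ι y)
      bad′? = ¬? ∘ commutesAt? (repair ζ y)
      y≢ιy : ∀ {x} → ¬ (x ≡ y × x ≡ ι y)
      y≢ιy (refl , y≡ιy) = ι-fixedPointFree y (sym y≡ιy)
      pair⊥bad′ : ∀ {x} → ¬ ((x ≡ y ⊎ x ≡ ι y) × ¬ CommutesAt (repair ζ y) x)
      pair⊥bad′ (inj₁ refl , ¬c) = ¬c repair-commutesAt
      pair⊥bad′ (inj₂ refl , ¬c) = ¬c (commutesAt-ι (repair ζ y) repair-commutesAt)
      ⊆bad : ∀ {x} → (x ≡ y ⊎ x ≡ ι y) ⊎ ¬ CommutesAt (repair ζ y) x → ¬ CommutesAt ζ x
      ⊆bad (inj₁ (inj₁ refl)) = y-bad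
      ⊆bad (inj₁ (inj₂ refl)) = ιy-bad
      ⊆bad (inj₂ ¬c) = ¬c ∘ commutesAt-repair

    distance-repair : distance (repair ζ y) ζ ≤ 2
    distance-repair = begin
      distance (repair ζ y) ζ
        ≤⟨ count-mono (differ? (repair ζ y) ζ) moved? repair-moves enum ⟩
      count moved? enum
        ≤⟨ count-∪ (_≟ ι y) (_≟ from ζ (ι (to ζ y))) enum ⟩
      count (_≟ ι y) enum + count (_≟ from ζ (ι (to ζ y))) enum
        ≤⟨ +-mono-≤ (count-≡-≤1 _≟_ enum-unique _) (count-≡-≤1 _≟_ enum-unique _) ⟩
      2
        ∎
      where
      open ≤-Reasoning
      moved? = (_≟ ι y) ∪? (_≟ from ζ (ι (to ζ y)))

  Approximation : A ↔ A → Set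
  Approximation ζ = Σ (A ↔ A) λ σ → (∀ x → CommutesAt σ x) × distance σ ζ ≤ defect ζ

  approximation : ∀ ζ → Approximation ζ
  approximation = WellFounded.All.wfRec (On.wellFounded defect <-wellFounded) 0ℓ Approximation step
    where
    step : ∀ ζ → (∀ {ζ′} → defect ζ′ < defect ζ → Approximation ζ′) → Approximation ζ
    step ζ rec with all? (commutesAt? ζ) enum
    ... | yes commutes =
      ζ , (λ x → All.lookup commutes (enum-complete x)) ,
      count-mono (differ? ζ ζ) (¬? ∘ commutesAt? ζ) (λ ζx≢ζx → contradiction refl ζx≢ζx) enum
    ... | no ¬commutes with satisfied (¬All⇒Any¬ (commutesAt? ζ) enum ¬commutes)
    ...   | y , y-bad with rec {repair ζ y} (≤-trans (n≤1+n _) (Repair.defect-repair ζ y-bad))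
    ...     | σ , σ-commutes , σ-close = σ , σ-commutes , (begin
      distance σ ζ                                       ≤⟨ distance-triangle σ (repair ζ y) ζ ⟩
      distance σ (repair ζ y) + distance (repair ζ y) ζ  ≤⟨ +-mono-≤ σ-close distance-repair ⟩
      defect (repair ζ y) + 2                            ≡⟨ +-comm _ 2 ⟩
      2 + defect (repair ζ y)                            ≤⟨ defect-repair ⟩
      defect ζ                                           ∎)
      where
      open ≤-Reasoning
      open Repair ζ y-bad

  commuting-approximation : ∀ ζ →
    Σ (A ↔ A) λ σ → (∀ x → CommutesAt σ x) × distance σ ζ ≤ commutatorSupport ζ
  commuting-approximation ζ with approximation ζ
  ... | σ , σ-commutes , σ-close =
    σ , σ-commutes , subst (distance σ ζ ≤_) (sym (commutatorSupport≡defect ζ)) σ-close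

module _ {n : ℕ} where

  flip-involutive : (x : Ωpm n) → flip (flip x) ≡ x
  flip-involutive (s , i) = cong (_, i) (not-involutive s)

  flip-fixedPointFree : (x : Ωpm n) → flip x ≢ x
  flip-fixedPointFree (s , i) e = not-¬ refl (sym (cong proj₁ e))

  elems-complete : (x : Ωpm n) → x ∈ elems n
  elems-complete (true , i) = ∈-++⁺ˡ (∈-map⁺ (true ,_) (∈-allFin i))
  elems-complete (false , i) = ∈-++⁺ʳ (map (true ,_) (allFin n)) (∈-map⁺ (false ,_) (∈-allFin i))

  elems-unique : Unique (elems n)
  elems-unique = Unique.++⁺ (signed true) (signed false) signs-differ
    where
    signed : ∀ s → Unique (map (s ,_) (allFin n))
    signed s = Unique.map⁺ ,-injectiveʳ (Unique.allFin⁺ n)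
    signs-differ : ∀ {x} → ¬ (x ∈ map (true ,_) (allFin n) × x ∈ map (false ,_) (allFin n))
    signs-differ (x∈₊ , x∈₋) with ∈-map⁻ (true ,_) x∈₊ | ∈-map⁻ (false ,_) x∈₋
    ... | _ , _ , refl | _ , _ , ()

claim2p4 : (n : ℕ) (ζ : Sym n) →
    Σ (Sym n) λ σ →
    ((x : Ωpm n) → app σ (app negId x) ≡ app negId (app σ x))
    × (hamCount σ ζ ≤ hamCount ⟦ negId , ζ ⟧ idₛ)
claim2p4 n = commuting-approximation
  where open CommutingApproximation _≟±_ flip flip-involutive flip-fixedPointFree elems-unique elems-complete
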